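{- Let $N$ be a nonzero integer and let $\mathbf{M}$ be a tame $N$-tiling with vertical tameness parameter $R$, horizontal tameness parameter $S$, and total tameness parameter $T$. Then $RS=T$.
   Context: An $N$-tiling is a function $\mathbf{M}\colon\mathcal{I}\times\mathcal{J}\to\mathbb{Z}$ ($\mathcal{I},\mathcal{J}$ sets of consecutive integers of length at least 3, possibly infinite), $m_{ij}=\mathbf{M}(i,j)$, with $m_{ij}m_{i+1,j+1}-m_{i,j+1}m_{i+1,j}=N$ for every contiguous $2\times2$ subblock; it is tame if every contiguous $3\times3$ subblock has determinant $0$. A $2\times2$ minor of $\mathbf{M}$ is $m_{ij}m_{i'j'}-m_{ij'}m_{i'j}$ with $i<i'$, $j<j'$. Let $r$ be the gcd of the minors from two consecutive columns $j,j+1$, $s$ the gcd of the minors from two consecutive rows $i,i+1$ (neither depends on the choice of columns/rows), and $t$ the gcd of all minors; if $N<0$, replace $r,s,t$ by their negatives. The vertical tameness parameter is $R=N/r$, the horizontal tameness parameter is $S=N/s$, and the total tameness parameter is $T=N/t$. -}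

module Defs where

open import Data.Nat using (ℕ)
open import Data.Nat.Divisibility using () renaming (_∣_ to _∣ℕ_)
import Data.Integer as ℤ
open import Data.Integer using (ℤ; +_; -_; _+_; _-_; _*_; _≤_; _<_; ∣_∣; 0ℤ; 1ℤ)
open import Data.Product using (Σ; _×_; ∃-syntax)
open import Relation.Binary.PropositionalEquality using (_≡_)

-- An index set: a predicate on ℤ describing a set of consecutive integers
-- (convex: an interval, possibly infinite on either side) of length ≥ 3.
record IndexSet : Set₁ where
  field
    mem    : ℤ → Set
    convex : ∀ {a b c} → mem a → mem c → a ≤ b → b ≤ c → mem b
    three  : ∃[ a ] (mem a × mem (a + + 2))
open IndexSet public

-- A matrix indexed by integers; only the values on 𝓘 × 𝓙 matter.
Matrix : Set
Matrix = ℤ → ℤ → ℤ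

minor : Matrix → ℤ → ℤ → ℤ → ℤ → ℤ
minor M i i' j j' = M i j * M i' j' - M i j' * M i' j

det3 : ℤ → ℤ → ℤ → ℤ → ℤ → ℤ → ℤ → ℤ → ℤ → ℤ
det3 a b c d e f g h k =
  a * (e * k - f * h) - b * (d * k - f * g) + c * (d * h - e * g)

IsTiling : ℤ → IndexSet → IndexSet → Matrix → Set
IsTiling N 𝓘 𝓙 M =
  ∀ i j → mem 𝓘 i → mem 𝓘 (i + 1ℤ) → mem 𝓙 j → mem 𝓙 (j + 1ℤ) →
  minor M i (i + 1ℤ) j (j + 1ℤ) ≡ N

IsTame : IndexSet → IndexSet → Matrix → Set
IsTame 𝓘 𝓙 M =
  ∀ i j → mem 𝓘 i → mem 𝓘 (i + + 2) → mem 𝓙 j → mem 𝓙 (j + + 2) →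
  det3 (M i j)         (M i (j + 1ℤ))         (M i (j + + 2))
       (M (i + 1ℤ) j)  (M (i + 1ℤ) (j + 1ℤ))  (M (i + 1ℤ) (j + + 2))
       (M (i + + 2) j) (M (i + + 2) (j + 1ℤ)) (M (i + + 2) (j + + 2))
  ≡ 0ℤ

IsGCDOf : (ℤ → Set) → ℕ → Set
IsGCDOf P g =
  (∀ x → P x → g ∣ℕ ∣ x ∣) ×
  (∀ d → (∀ x → P x → d ∣ℕ ∣ x ∣) → d ∣ℕ g)

ColMinor : IndexSet → Matrix → ℤ → ℤ → Set
ColMinor 𝓘 M j x =
  ∃[ i ] ∃[ i' ] (mem 𝓘 i × mem 𝓘 i' × i < i' × x ≡ minor M i i' j (j + 1ℤ))

RowMinor : IndexSet → Matrix → ℤ → ℤ → Set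
RowMinor 𝓙 M i x =
  ∃[ j ] ∃[ j' ] (mem 𝓙 j × mem 𝓙 j' × j < j' × x ≡ minor M i (i + 1ℤ) j j')

AnyMinor : IndexSet → IndexSet → Matrix → ℤ → Set
AnyMinor 𝓘 𝓙 M x =
  ∃[ i ] ∃[ i' ] ∃[ j ] ∃[ j' ]
    (mem 𝓘 i × mem 𝓘 i' × mem 𝓙 j × mem 𝓙 j' × i < i' × j < j' ×
     x ≡ minor M i i' j j')

signedBy : ℤ → ℕ → ℤ
signedBy (+ _)      g = + g
signedBy (ℤ.negsuc _) g = - (+ g)

{-# OPTIONS --safe #-}
module Submission where

-- Tameness makes every contiguous 3×3 block singular while all its contiguous 2×2 minors
-- equal N ≠ 0, so three consecutive rows satisfy N·(row a + row (a+2)) = c_a·row (a+1) with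
-- c_a independent of the column.  Propagating this recurrence from rows i, i+1 shows that
-- every row is a rational combination of rows i and i+1; Cramer's rule and Cauchy–Binet
-- then give, for every 2×2 minor,
--   N · m(a,a′; b,b′) = m(a,a′; j,j+1) · m(i,i+1; b,b′).
-- So the products (column minor)·(row minor) are exactly |N| times the minors, whence
-- gcd_col · gcd_row = |N| · gcd_all, i.e. (N/R)(N/S) = N·(N/T), which is RS = T.

open import Defs
open import Data.Nat.Base as ℕ using (ℕ; zero; suc; s≤s; z≤n)
import Data.Nat.Properties as ℕ
open import Data.Nat.Divisibility
  using (_∣_; _∣0; ∣-trans; ∣-antisym; n∣m*n; *-pres-∣; *-monoʳ-∣; *-cancelˡ-∣)
open import Data.Nat.DivMod using (_/_; m*[n/m]≡n)
open import Data.Nat.GCD using (gcd; gcd[m,n]∣m; gcd[m,n]∣n; gcd[m,n]≡0⇒n≡0)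
open import Data.Nat.Coprimality using (coprime-/gcd; coprime-divisor)
open import Data.Integer.Base as ℤ
  using (ℤ; +_; -[1+_]; -_; _+_; _-_; _*_; ∣_∣; 0ℤ; 1ℤ; +≤+)
import Data.Integer.Properties as ℤ
open import Data.Integer.Tactic.RingSolver using (solve-∀)
open import Data.Product using (_,_; _×_; proj₁; proj₂; ∃-syntax)
open import Relation.Binary.PropositionalEquality
open import Relation.Nullary using (yes; no)
open import Data.Sum using (inj₁; inj₂)

-- d / gcd d k and k / gcd d k are coprime, so d / gcd d k divides every ∣ x ∣, hence g.
∣-*-gcd : ∀ {X g} → IsGCDOf X g → ∀ {d} k → (∀ x → X x → d ∣ k ℕ.* ∣ x ∣) → d ∣ k ℕ.* g
∣-*-gcd {X} {g} (_ , greatest) {d} k d∣k*X with gcd d k ℕ.≟ 0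
... | yes h≡0 = subst (λ k → d ∣ k ℕ.* g) (sym (gcd[m,n]≡0⇒n≡0 d h≡0)) (d ∣0)
... | no h≢0 = subst₂ _∣_ h*d′≡d h*[k′*g]≡k*g (*-monoʳ-∣ h (∣-trans (greatest d′ d′∣X) (n∣m*n k′)))
  where
  h = gcd d k
  instance
    h-nonZero : ℕ.NonZero h
    h-nonZero = ℕ.≢-nonZero h≢0
  d′ = d / h
  k′ = k / h
  h*d′≡d : h ℕ.* d′ ≡ d
  h*d′≡d = m*[n/m]≡n (gcd[m,n]∣m d k)
  h*k′≡k : h ℕ.* k′ ≡ k
  h*k′≡k = m*[n/m]≡n (gcd[m,n]∣n d k)
  h*[k′*g]≡k*g : h ℕ.* (k′ ℕ.* g) ≡ k ℕ.* g
  h*[k′*g]≡k*g = trans (sym (ℕ.*-assoc h k′ g)) (cong (ℕ._* g) h*k′≡k)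
  d′∣X : ∀ x → X x → d′ ∣ ∣ x ∣
  d′∣X x x∈X = coprime-divisor (coprime-/gcd d k) (*-cancelˡ-∣ h
    (subst₂ _∣_ (sym h*d′≡d) (trans (cong (ℕ._* ∣ x ∣) (sym h*k′≡k)) (ℕ.*-assoc h k′ ∣ x ∣)) (d∣k*X x x∈X)))

gcd-of-products : ∀ {X Y Z gx gy gz} n → IsGCDOf X gx → IsGCDOf Y gy → IsGCDOf Z gz →
  (∀ {x y} → X x → Y y → ∃[ z ] (Z z × ∣ x ∣ ℕ.* ∣ y ∣ ≡ n ℕ.* ∣ z ∣)) →
  (∀ {z} → Z z → ∃[ x ] ∃[ y ] (X x × Y y × ∣ x ∣ ℕ.* ∣ y ∣ ≡ n ℕ.* ∣ z ∣)) →
  gx ℕ.* gy ≡ n ℕ.* gz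
gcd-of-products {X} {Y} {Z} {gx} {gy} {gz} n X-gcd Y-gcd Z-gcd X×Y⊆Z Z⊆X×Y =
  ∣-antisym (∣-*-gcd Z-gcd n gx*gy∣n*Z) (subst (n ℕ.* gz ∣_) (ℕ.*-comm gy gx) (∣-*-gcd X-gcd gy n*gz∣gy*X))
  where
  gx*gy∣n*Z : ∀ z → Z z → gx ℕ.* gy ∣ n ℕ.* ∣ z ∣
  gx*gy∣n*Z z z∈Z with Z⊆X×Y z∈Z
  ... | x , y , x∈X , y∈Y , eq = subst (gx ℕ.* gy ∣_) eq (*-pres-∣ (proj₁ X-gcd x x∈X) (proj₁ Y-gcd y y∈Y))
  n*gz∣gy*X : ∀ x → X x → n ℕ.* gz ∣ gy ℕ.* ∣ x ∣
  n*gz∣gy*X x x∈X = subst (n ℕ.* gz ∣_) (ℕ.*-comm ∣ x ∣ gy) (∣-*-gcd Y-gcd ∣ x ∣ n*gz∣x*Y)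
    where
    n*gz∣x*Y : ∀ y → Y y → n ℕ.* gz ∣ ∣ x ∣ ℕ.* ∣ y ∣
    n*gz∣x*Y y y∈Y with X×Y⊆Z x∈X y∈Y
    ... | z , z∈Z , eq = subst (n ℕ.* gz ∣_) (sym eq) (*-monoʳ-∣ n (proj₁ Z-gcd z z∈Z))

-i*-j≡i*j : ∀ i j → - i * - j ≡ i * j
-i*-j≡i*j = solve-∀

signedBy-*-signedBy : ∀ N a b → signedBy N a * signedBy N b ≡ + (a ℕ.* b)
signedBy-*-signedBy (+ _)    a b = sym (ℤ.pos-* a b)
signedBy-*-signedBy -[1+ _ ] a b = trans (-i*-j≡i*j (+ a) (+ b)) (sym (ℤ.pos-* a b))

*-signedBy : ∀ N g → N * signedBy N g ≡ + (∣ N ∣ ℕ.* g)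
*-signedBy (+ n)    g = sym (ℤ.pos-* n g)
*-signedBy -[1+ n ] g = trans (-i*-j≡i*j (+ suc n) (+ g)) (sym (ℤ.pos-* (suc n) g))

tameness-parameters-multiply : ∀ {N gr gs gt} (R S T : ℤ) → N ≢ 0ℤ → gr ℕ.* gs ≡ ∣ N ∣ ℕ.* gt →
  N ≡ R * signedBy N gr → N ≡ S * signedBy N gs → N ≡ T * signedBy N gt → R * S ≡ T
tameness-parameters-multiply {N} {gr} {gs} {gt} R S T N≢0 gr*gs≡∣N∣*gt N≡Rr N≡Ss N≡Tt =
  ℤ.*-cancelˡ-≡ (N * t) (R * S) T {{ℤ.≢-nonZero Nt≢0}} (begin
    N * t * (R * S)     ≡⟨ cong (_* (R * S)) rs≡Nt ⟨
    r * s * (R * S)     ≡⟨ regroup r s R S ⟩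
    R * r * (S * s)     ≡⟨ cong₂ _*_ N≡Rr N≡Ss ⟨
    N * N               ≡⟨ cong (N *_) N≡Tt ⟩
    N * (T * t)         ≡⟨ regroup′ N T t ⟩
    N * t * T           ∎)
  where
  open ≡-Reasoning
  r = signedBy N gr
  s = signedBy N gs
  t = signedBy N gt
  rs≡Nt : r * s ≡ N * t
  rs≡Nt = begin
    r * s             ≡⟨ signedBy-*-signedBy N gr gs ⟩
    + (gr ℕ.* gs)     ≡⟨ cong +_ gr*gs≡∣N∣*gt ⟩
    + (∣ N ∣ ℕ.* gt)  ≡⟨ *-signedBy N gt ⟨
    N * t             ∎
  regroup : ∀ r s R S → r * s * (R * S) ≡ R * r * (S * s)
  regroup = solve-∀
  regroup′ : ∀ N T t → N * (T * t) ≡ N * t * T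
  regroup′ = solve-∀
  Nt≢0 : N * t ≢ 0ℤ
  Nt≢0 Nt≡0 with ℤ.i*j≡0⇒i≡0∨j≡0 N Nt≡0
  ... | inj₁ N≡0 = N≢0 N≡0
  ... | inj₂ t≡0 = N≢0 (trans N≡Tt (trans (cong (T *_) t≡0) (ℤ.*-zeroʳ T)))

module _ (𝓚 : IndexSet) where

  mem-mid : ∀ {x} → mem 𝓚 x → mem 𝓚 (x + + 2) → mem 𝓚 (x + 1ℤ)
  mem-mid {x} x∈𝓚 x+2∈𝓚 = convex 𝓚 x∈𝓚 x+2∈𝓚 (ℤ.i≤i+j x 1ℤ) (ℤ.+-monoʳ-≤ x (+≤+ (s≤s z≤n)))

  induction₂ : (P : ℤ → Set) {x₀ : ℤ} → mem 𝓚 x₀ → mem 𝓚 (x₀ + 1ℤ) → P x₀ → P (x₀ + 1ℤ) →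
    (∀ {x} → mem 𝓚 x → mem 𝓚 (x + + 2) → P x → P (x + 1ℤ) → P (x + + 2)) →
    (∀ {x} → mem 𝓚 x → mem 𝓚 (x + + 2) → P (x + 1ℤ) → P (x + + 2) → P x) →
    ∀ {y} → mem 𝓚 y → P y
  induction₂ P {x₀} x₀∈𝓚 x₀+1∈𝓚 Px₀ Px₀+1 up down {y} y∈𝓚 =
    subst P (x+[y-x]≡y x₀ y) (reach (y - x₀) (subst (mem 𝓚) (sym (x+[y-x]≡y x₀ y)) y∈𝓚))
    where
    x+[y-x]≡y : ∀ x y → x + (y - x) ≡ y
    x+[y-x]≡y = solve-∀
    [x-1]+1≡x : ∀ x → x - 1ℤ + 1ℤ ≡ x
    [x-1]+1≡x = solve-∀
    [x-1]+2≡x+1 : ∀ x → x - 1ℤ + + 2 ≡ x + 1ℤ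
    [x-1]+2≡x+1 = solve-∀
    [x-1]-n≡x-[1+n] : ∀ x n → x - 1ℤ - n ≡ x - (1ℤ + n)
    [x-1]-n≡x-[1+n] = solve-∀

    upward : ∀ n {x} → mem 𝓚 x → mem 𝓚 (x + 1ℤ) → P x → P (x + 1ℤ) → mem 𝓚 (x + + n) → P (x + + n)
    upward zero          {x} _   _     Px _     _     = subst P (sym (ℤ.+-identityʳ x)) Px
    upward (suc zero)        _   _     _  Px+1  _     = Px+1
    upward (suc (suc n)) {x} x∈𝓚 x+1∈𝓚 Px Px+1 x+n∈𝓚 =
      subst P (ℤ.+-assoc x 1ℤ (+ suc n))
        (upward (suc n) x+1∈𝓚 (subst (mem 𝓚) (sym (ℤ.+-assoc x 1ℤ 1ℤ)) x+2∈𝓚)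
          Px+1 (subst P (sym (ℤ.+-assoc x 1ℤ 1ℤ)) (up x∈𝓚 x+2∈𝓚 Px Px+1))
          (subst (mem 𝓚) (sym (ℤ.+-assoc x 1ℤ (+ suc n))) x+n∈𝓚))
      where
      x+2∈𝓚 : mem 𝓚 (x + + 2)
      x+2∈𝓚 = convex 𝓚 x∈𝓚 x+n∈𝓚 (ℤ.i≤i+j x (+ 2)) (ℤ.+-monoʳ-≤ x (+≤+ (s≤s (s≤s z≤n))))

    downward : ∀ n {x} → mem 𝓚 x → mem 𝓚 (x + 1ℤ) → P x → P (x + 1ℤ) → mem 𝓚 (x - + n) → P (x - + n)
    downward zero    {x} _   _     Px _    _     = subst P (sym (ℤ.+-identityʳ x)) Px
    downward (suc n) {x} x∈𝓚 x+1∈𝓚 Px Px+1 x-n∈𝓚 =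
      subst P ([x-1]-n≡x-[1+n] x (+ n))
        (downward n x-1∈𝓚 (subst (mem 𝓚) (sym ([x-1]+1≡x x)) x∈𝓚)
          (down x-1∈𝓚 (subst (mem 𝓚) (sym ([x-1]+2≡x+1 x)) x+1∈𝓚)
            (subst P (sym ([x-1]+1≡x x)) Px) (subst P (sym ([x-1]+2≡x+1 x)) Px+1))
          (subst P (sym ([x-1]+1≡x x)) Px)
          (subst (mem 𝓚) (sym ([x-1]-n≡x-[1+n] x (+ n))) x-n∈𝓚))
      where
      x-1∈𝓚 : mem 𝓚 (x - 1ℤ)
      x-1∈𝓚 = convex 𝓚 x-n∈𝓚 x∈𝓚 (ℤ.+-monoʳ-≤ x (ℤ.neg-mono-≤ (+≤+ (s≤s z≤n)))) (ℤ.i-j≤i x 1ℤ)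

    reach : ∀ d → mem 𝓚 (x₀ + d) → P (x₀ + d)
    reach (+ n)    = upward n x₀∈𝓚 x₀+1∈𝓚 Px₀ Px₀+1
    reach -[1+ n ] = downward (suc n) x₀∈𝓚 x₀+1∈𝓚 Px₀ Px₀+1

minor₃ : Matrix → ℤ → ℤ → ℤ → ℤ → ℤ → ℤ → ℤ
minor₃ M r₁ r₂ r₃ c₁ c₂ c₃ =
  det3 (M r₁ c₁) (M r₁ c₂) (M r₁ c₃) (M r₂ c₁) (M r₂ c₂) (M r₂ c₃) (M r₃ c₁) (M r₃ c₂) (M r₃ c₃)

*-cancelˡ-≡0 : ∀ {i j} → i ≢ 0ℤ → i * j ≡ 0ℤ → j ≡ 0ℤ
*-cancelˡ-≡0 {i} {j} i≢0 ij≡0 =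
  ℤ.*-cancelˡ-≡ i j 0ℤ {{ℤ.≢-nonZero i≢0}} (trans ij≡0 (sym (ℤ.*-zeroʳ i)))

module _ (M : Matrix) where

  Recurrence : ℤ → ℤ → ℤ → ℤ → ℤ → ℤ → Set
  Recurrence N c r₁ r₂ r₃ l = N * M r₁ l - c * M r₂ l + N * M r₃ l ≡ 0ℤ

  Recurrence-sym : ∀ N c {r₁ r₂ r₃ l} → Recurrence N c r₁ r₂ r₃ l → Recurrence N c r₃ r₂ r₁ l
  Recurrence-sym N c {r₁} {r₂} {r₃} {l} = trans (swap N c (M r₁ l) (M r₂ l) (M r₃ l))
    where
    swap : ∀ N c x y z → N * z - c * y + N * x ≡ N * x - c * y + N * z
    swap = solve-∀

  recurrence-from-minors : ∀ {N r₁ r₂ r₃ c₁ c₂} → minor M r₁ r₂ c₁ c₂ ≡ N → minor M r₂ r₃ c₁ c₂ ≡ N →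
    Recurrence N (minor M r₁ r₃ c₁ c₂) r₁ r₂ r₃ c₁ × Recurrence N (minor M r₁ r₃ c₁ c₂) r₁ r₂ r₃ c₂
  recurrence-from-minors {r₁ = r₁} {r₂} {r₃} {c₁} {c₂} refl m₂₃≡m₁₂ =
    subst (λ n → n * x₁ - c * y₁ + m₁₂ * z₁ ≡ 0ℤ) m₂₃≡m₁₂ (column₁ x₁ x₂ y₁ y₂ z₁ z₂) ,
    subst (λ n → n * x₂ - c * y₂ + m₁₂ * z₂ ≡ 0ℤ) m₂₃≡m₁₂ (column₂ x₁ x₂ y₁ y₂ z₁ z₂)
    where
    x₁ = M r₁ c₁ ; x₂ = M r₁ c₂ ; y₁ = M r₂ c₁ ; y₂ = M r₂ c₂ ; z₁ = M r₃ c₁ ; z₂ = M r₃ c₂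
    c = minor M r₁ r₃ c₁ c₂
    m₁₂ = minor M r₁ r₂ c₁ c₂
    column₁ : ∀ x₁ x₂ y₁ y₂ z₁ z₂ →
      (y₁ * z₂ - y₂ * z₁) * x₁ - (x₁ * z₂ - x₂ * z₁) * y₁ + (x₁ * y₂ - x₂ * y₁) * z₁ ≡ 0ℤ
    column₁ = solve-∀
    column₂ : ∀ x₁ x₂ y₁ y₂ z₁ z₂ →
      (y₁ * z₂ - y₂ * z₁) * x₂ - (x₁ * z₂ - x₂ * z₁) * y₂ + (x₁ * y₂ - x₂ * y₁) * z₂ ≡ 0ℤ
    column₂ = solve-∀

  minor₃-rotate : ∀ {r₁ r₂ r₃ c₁ c₂ c₃} → minor₃ M r₁ r₂ r₃ c₁ c₂ c₃ ≡ minor₃ M r₁ r₂ r₃ c₂ c₃ c₁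
  minor₃-rotate {r₁} {r₂} {r₃} {c₁} {c₂} {c₃} =
    rotate (M r₁ c₁) (M r₁ c₂) (M r₁ c₃) (M r₂ c₁) (M r₂ c₂) (M r₂ c₃) (M r₃ c₁) (M r₃ c₂) (M r₃ c₃)
    where
    rotate : ∀ a b c d e f g h k →
      a * (e * k - f * h) - b * (d * k - f * g) + c * (d * h - e * g)
      ≡ b * (f * g - d * k) - c * (e * g - d * h) + a * (e * k - f * h)
    rotate = solve-∀

  minor₃-rows₁₂ : ∀ {r r′ c₁ c₂ c₃} → minor₃ M r r r′ c₁ c₂ c₃ ≡ 0ℤ
  minor₃-rows₁₂ {r} {r′} {c₁} {c₂} {c₃} =
    vanish (M r c₁) (M r c₂) (M r c₃) (M r′ c₁) (M r′ c₂) (M r′ c₃)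
    where
    vanish : ∀ a b c g h k → a * (b * k - c * h) - b * (a * k - c * g) + c * (a * h - b * g) ≡ 0ℤ
    vanish = solve-∀

  minor₃-rows₁₃ : ∀ {r r′ c₁ c₂ c₃} → minor₃ M r r′ r c₁ c₂ c₃ ≡ 0ℤ
  minor₃-rows₁₃ {r} {r′} {c₁} {c₂} {c₃} =
    vanish (M r c₁) (M r c₂) (M r c₃) (M r′ c₁) (M r′ c₂) (M r′ c₃)
    where
    vanish : ∀ a b c d e f → a * (e * c - f * b) - b * (d * c - f * a) + c * (d * b - e * a) ≡ 0ℤ
    vanish = solve-∀

  recurrence-third : ∀ N c {r₁ r₂ r₃ c₁ c₂ c₃} →
    minor M r₂ r₃ c₁ c₂ ≢ 0ℤ → minor₃ M r₁ r₂ r₃ c₁ c₂ c₃ ≡ 0ℤ →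
    Recurrence N c r₁ r₂ r₃ c₁ → Recurrence N c r₁ r₂ r₃ c₂ → Recurrence N c r₁ r₂ r₃ c₃
  recurrence-third N c {r₁} {r₂} {r₃} {c₁} {c₂} {c₃} m₁₂≢0 det≡0 ψ₁≡0 ψ₂≡0 =
    *-cancelˡ-≡0 m₁₂≢0 (begin
      m₁₂ * ψ c₃
        ≡⟨ add-zeros (m₁₂ * ψ c₃) m₂₃ m₃₁ ⟩
      m₁₂ * ψ c₃ + m₂₃ * 0ℤ + m₃₁ * 0ℤ
        ≡⟨ cong₂ (λ u v → m₁₂ * ψ c₃ + m₂₃ * u + m₃₁ * v) ψ₁≡0 ψ₂≡0 ⟨
      m₁₂ * ψ c₃ + m₂₃ * ψ c₁ + m₃₁ * ψ c₂
        ≡⟨ expansion N c (M r₁ c₁) (M r₁ c₂) (M r₁ c₃) (M r₂ c₁) (M r₂ c₂) (M r₂ c₃)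
                         (M r₃ c₁) (M r₃ c₂) (M r₃ c₃) ⟩
      N * minor₃ M r₁ r₂ r₃ c₁ c₂ c₃
        ≡⟨ cong (N *_) det≡0 ⟩
      N * 0ℤ
        ≡⟨ ℤ.*-zeroʳ N ⟩
      0ℤ
        ∎)
    where
    open ≡-Reasoning
    ψ : ℤ → ℤ
    ψ l = N * M r₁ l - c * M r₂ l + N * M r₃ l
    m₁₂ = minor M r₂ r₃ c₁ c₂
    m₂₃ = minor M r₂ r₃ c₂ c₃
    m₃₁ = minor M r₂ r₃ c₃ c₁
    add-zeros : ∀ a b c → a ≡ a + b * 0ℤ + c * 0ℤ
    add-zeros = solve-∀
    expansion : ∀ N c x₁ x₂ x₃ y₁ y₂ y₃ z₁ z₂ z₃ →
        (y₁ * z₂ - y₂ * z₁) * (N * x₃ - c * y₃ + N * z₃)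
      + (y₂ * z₃ - y₃ * z₂) * (N * x₁ - c * y₁ + N * z₁)
      + (y₃ * z₁ - y₁ * z₃) * (N * x₂ - c * y₂ + N * z₂)
      ≡ N * (x₁ * (y₂ * z₃ - y₃ * z₂) - x₂ * (y₁ * z₃ - y₃ * z₁) + x₃ * (y₁ * z₂ - y₂ * z₁))
    expansion = solve-∀

  minor₃-recurrence : ∀ c {N r₁ r₂ r₃ s₁ s₂ c₁ c₂ c₃} → N ≢ 0ℤ →
    Recurrence N c r₁ r₂ r₃ c₁ → Recurrence N c r₁ r₂ r₃ c₂ → Recurrence N c r₁ r₂ r₃ c₃ →
    minor₃ M r₁ s₁ s₂ c₁ c₂ c₃ ≡ 0ℤ → minor₃ M r₂ s₁ s₂ c₁ c₂ c₃ ≡ 0ℤ → minor₃ M r₃ s₁ s₂ c₁ c₂ c₃ ≡ 0ℤ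
  minor₃-recurrence c {N} {r₁} {r₂} {r₃} {s₁} {s₂} {c₁} {c₂} {c₃} N≢0 ψ₁≡0 ψ₂≡0 ψ₃≡0 D₁≡0 D₂≡0 =
    *-cancelˡ-≡0 N≢0 (begin
      N * D r₃
        ≡⟨ add-zeros (N * D r₃) N c ⟩
      N * 0ℤ - c * 0ℤ + N * D r₃
        ≡⟨ cong₂ (λ u v → N * u - c * v + N * D r₃) D₁≡0 D₂≡0 ⟨
      N * D r₁ - c * D r₂ + N * D r₃
        ≡⟨ first-row-linear N c (M r₁ c₁) (M r₁ c₂) (M r₁ c₃) (M r₂ c₁) (M r₂ c₂) (M r₂ c₃)
                                (M r₃ c₁) (M r₃ c₂) (M r₃ c₃) (M s₁ c₁) (M s₁ c₂) (M s₁ c₃)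
                                (M s₂ c₁) (M s₂ c₂) (M s₂ c₃) ⟩
      Δ (ψ c₁) (ψ c₂) (ψ c₃)
        ≡⟨ cong₂ (λ u v → Δ u v (ψ c₃)) ψ₁≡0 ψ₂≡0 ⟩
      Δ 0ℤ 0ℤ (ψ c₃)
        ≡⟨ cong (Δ 0ℤ 0ℤ) ψ₃≡0 ⟩
      Δ 0ℤ 0ℤ 0ℤ
        ≡⟨⟩
      0ℤ
        ∎)
    where
    open ≡-Reasoning
    ψ : ℤ → ℤ
    ψ l = N * M r₁ l - c * M r₂ l + N * M r₃ l
    Δ : ℤ → ℤ → ℤ → ℤ
    Δ u v w = det3 u v w (M s₁ c₁) (M s₁ c₂) (M s₁ c₃) (M s₂ c₁) (M s₂ c₂) (M s₂ c₃)
    D : ℤ → ℤ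
    D r = Δ (M r c₁) (M r c₂) (M r c₃)
    add-zeros : ∀ a N c → a ≡ N * 0ℤ - c * 0ℤ + a
    add-zeros = solve-∀
    first-row-linear : ∀ N c x₁ x₂ x₃ y₁ y₂ y₃ z₁ z₂ z₃ p₁ p₂ p₃ q₁ q₂ q₃ →
        N * (x₁ * (p₂ * q₃ - p₃ * q₂) - x₂ * (p₁ * q₃ - p₃ * q₁) + x₃ * (p₁ * q₂ - p₂ * q₁))
      - c * (y₁ * (p₂ * q₃ - p₃ * q₂) - y₂ * (p₁ * q₃ - p₃ * q₁) + y₃ * (p₁ * q₂ - p₂ * q₁))
      + N * (z₁ * (p₂ * q₃ - p₃ * q₂) - z₂ * (p₁ * q₃ - p₃ * q₁) + z₃ * (p₁ * q₂ - p₂ * q₁))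
      ≡ (N * x₁ - c * y₁ + N * z₁) * (p₂ * q₃ - p₃ * q₂)
      - (N * x₂ - c * y₂ + N * z₂) * (p₁ * q₃ - p₃ * q₁)
      + (N * x₃ - c * y₃ + N * z₃) * (p₁ * q₂ - p₂ * q₁)
    first-row-linear = solve-∀

  cramer : ∀ {a r r′ c₁ c₂ t} → minor₃ M a r r′ c₁ c₂ t ≡ 0ℤ →
    minor M r r′ c₁ c₂ * M a t ≡ minor M a r′ c₁ c₂ * M r t + minor M r a c₁ c₂ * M r′ t
  cramer {a} {r} {r′} {c₁} {c₂} {t} D≡0 =
    trans (expansion (M a c₁) (M a c₂) (M a t) (M r c₁) (M r c₂) (M r t) (M r′ c₁) (M r′ c₂) (M r′ t))
      (trans (cong (λ d → combination + d) D≡0) (ℤ.+-identityʳ combination))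
    where
    combination = minor M a r′ c₁ c₂ * M r t + minor M r a c₁ c₂ * M r′ t
    expansion : ∀ x₁ x₂ x₃ y₁ y₂ y₃ z₁ z₂ z₃ →
      (y₁ * z₂ - y₂ * z₁) * x₃
      ≡ (x₁ * z₂ - x₂ * z₁) * y₃ + (y₁ * x₂ - y₂ * x₁) * z₃
      + (x₁ * (y₂ * z₃ - y₃ * z₂) - x₂ * (y₁ * z₃ - y₃ * z₁) + x₃ * (y₁ * z₂ - y₂ * z₁))
    expansion = solve-∀

  -- By Cramer's rule Y·(row a) = P a·(row r) + Q a·(row r′) on the columns b, b′, so
  -- Cauchy–Binet gives Y²·m(a,a′;b,b′) = Δ·m(r,r′;b,b′); on the pivot columns Y²·m(a,a′;c₁,c₂) = Δ·Y.
  minor-factorisation : ∀ {a a′ r r′ c₁ c₂ b b′} → minor M r r′ c₁ c₂ ≢ 0ℤ →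
    minor₃ M a r r′ c₁ c₂ b ≡ 0ℤ → minor₃ M a r r′ c₁ c₂ b′ ≡ 0ℤ →
    minor₃ M a′ r r′ c₁ c₂ b ≡ 0ℤ → minor₃ M a′ r r′ c₁ c₂ b′ ≡ 0ℤ →
    minor M r r′ c₁ c₂ * minor M a a′ b b′ ≡ minor M a a′ c₁ c₂ * minor M r r′ b b′
  minor-factorisation {a} {a′} {r} {r′} {c₁} {c₂} {b} {b′} Y≢0 D-ab D-ab′ D-a′b D-a′b′ =
    ℤ.*-cancelˡ-≡ (Y * Y) _ _ (begin
      Y * Y * (Y * minor M a a′ b b′)          ≡⟨ reassociate Y (minor M a a′ b b′) ⟩
      Y * (Y * Y * minor M a a′ b b′)          ≡⟨ cong (Y *_) cauchy-binet ⟩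
      Y * (Δ * minor M r r′ b b′)              ≡⟨ commute Y Δ (minor M r r′ b b′) ⟩
      Δ * Y * minor M r r′ b b′                ≡⟨ cong (_* minor M r r′ b b′) pivot ⟨
      Y * Y * minor M a a′ c₁ c₂ * minor M r r′ b b′ ≡⟨ ℤ.*-assoc (Y * Y) _ _ ⟩
      Y * Y * (minor M a a′ c₁ c₂ * minor M r r′ b b′) ∎)
    where
    open ≡-Reasoning
    Y = minor M r r′ c₁ c₂
    instance
      Y-nonZero : ℤ.NonZero Y
      Y-nonZero = ℤ.≢-nonZero Y≢0
      YY-nonZero : ℤ.NonZero (Y * Y)
      YY-nonZero = ℤ.i*j≢0 Y Y
    P Q : ℤ → ℤ
    P x = minor M x r′ c₁ c₂
    Q x = minor M r x c₁ c₂
    Δ = P a * Q a′ - Q a * P a′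
    commute : ∀ Y Δ m → Y * (Δ * m) ≡ Δ * Y * m
    commute = solve-∀
    reassociate : ∀ Y m → Y * Y * (Y * m) ≡ Y * (Y * Y * m)
    reassociate = solve-∀
    cauchy-binet : Y * Y * minor M a a′ b b′ ≡ Δ * minor M r r′ b b′
    cauchy-binet = begin
      Y * Y * (M a b * M a′ b′ - M a b′ * M a′ b)
        ≡⟨ split Y (M a b) (M a′ b′) (M a b′) (M a′ b) ⟩
      Y * M a b * (Y * M a′ b′) - Y * M a b′ * (Y * M a′ b)
        ≡⟨ cong₂ _-_ (cong₂ _*_ (cramer D-ab) (cramer D-a′b′)) (cong₂ _*_ (cramer D-ab′) (cramer D-a′b)) ⟩
      (P a * M r b + Q a * M r′ b) * (P a′ * M r b′ + Q a′ * M r′ b′)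
        - (P a * M r b′ + Q a * M r′ b′) * (P a′ * M r b + Q a′ * M r′ b)
        ≡⟨ combine (P a) (Q a) (P a′) (Q a′) (M r b) (M r b′) (M r′ b) (M r′ b′) ⟩
      Δ * minor M r r′ b b′
        ∎
      where
      split : ∀ Y u v u′ v′ → Y * Y * (u * v - u′ * v′) ≡ Y * u * (Y * v) - Y * u′ * (Y * v′)
      split = solve-∀
      combine : ∀ p q p′ q′ y y′ z z′ →
        (p * y + q * z) * (p′ * y′ + q′ * z′) - (p * y′ + q * z′) * (p′ * y + q′ * z)
        ≡ (p * q′ - q * p′) * (y * z′ - y′ * z)
      combine = solve-∀
    pivot : Y * Y * minor M a a′ c₁ c₂ ≡ Δ * Y
    pivot = identity (M a c₁) (M a c₂) (M a′ c₁) (M a′ c₂) (M r c₁) (M r c₂) (M r′ c₁) (M r′ c₂)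
      where
      identity : ∀ x₁ x₂ x′₁ x′₂ y₁ y₂ z₁ z₂ →
        (y₁ * z₂ - y₂ * z₁) * (y₁ * z₂ - y₂ * z₁) * (x₁ * x′₂ - x₂ * x′₁)
        ≡ ((x₁ * z₂ - x₂ * z₁) * (y₁ * x′₂ - y₂ * x′₁) - (y₁ * x₂ - y₂ * x₁) * (x′₁ * z₂ - x′₂ * z₁))
          * (y₁ * z₂ - y₂ * z₁)
      identity = solve-∀

module TameTiling {N : ℤ} (𝓘 𝓙 : IndexSet) (M : Matrix) (N≢0 : N ≢ 0ℤ)
                  (tiling : IsTiling N 𝓘 𝓙 M) (tame : IsTame 𝓘 𝓙 M) where

  nonsingular : ∀ {x} → x ≡ N → x ≢ 0ℤ
  nonsingular x≡N x≡0 = N≢0 (trans (sym x≡N) x≡0)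

  tiling-at : ∀ {a a′ l l′} → a′ ≡ a + 1ℤ → l′ ≡ l + 1ℤ →
    mem 𝓘 a → mem 𝓘 a′ → mem 𝓙 l → mem 𝓙 l′ → minor M a a′ l l′ ≡ N
  tiling-at refl refl = tiling _ _

  rows-recurrence : ∀ {a j} → mem 𝓘 a → mem 𝓘 (a + + 2) → mem 𝓙 j → mem 𝓙 (j + 1ℤ) →
    ∀ {l} → mem 𝓙 l → Recurrence M N (minor M a (a + + 2) j (j + 1ℤ)) a (a + 1ℤ) (a + + 2) l
  rows-recurrence {a} {j} a∈𝓘 a+2∈𝓘 j∈𝓙 j+1∈𝓙 =
    induction₂ 𝓙 Rec j∈𝓙 j+1∈𝓙 (proj₁ base) (proj₂ base) up down
    where
    c = minor M a (a + + 2) j (j + 1ℤ)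
    Rec : ℤ → Set
    Rec = Recurrence M N c a (a + 1ℤ) (a + + 2)
    a+1∈𝓘 = mem-mid 𝓘 a∈𝓘 a+2∈𝓘
    lower-tiling : ∀ {l l′} → l′ ≡ l + 1ℤ → mem 𝓙 l → mem 𝓙 l′ → minor M (a + 1ℤ) (a + + 2) l l′ ≡ N
    lower-tiling l′≡l+1 = tiling-at (sym (ℤ.+-assoc a 1ℤ 1ℤ)) l′≡l+1 a+1∈𝓘 a+2∈𝓘
    base = recurrence-from-minors M (tiling a j a∈𝓘 a+1∈𝓘 j∈𝓙 j+1∈𝓙) (lower-tiling refl j∈𝓙 j+1∈𝓙)
    up : ∀ {l} → mem 𝓙 l → mem 𝓙 (l + + 2) → Rec l → Rec (l + 1ℤ) → Rec (l + + 2)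
    up {l} l∈𝓙 l+2∈𝓙 = recurrence-third M N c
      (nonsingular (lower-tiling refl l∈𝓙 (mem-mid 𝓙 l∈𝓙 l+2∈𝓙))) (tame a l a∈𝓘 a+2∈𝓘 l∈𝓙 l+2∈𝓙)
    down : ∀ {l} → mem 𝓙 l → mem 𝓙 (l + + 2) → Rec (l + 1ℤ) → Rec (l + + 2) → Rec l
    down {l} l∈𝓙 l+2∈𝓙 = recurrence-third M N c
      (nonsingular (lower-tiling (sym (ℤ.+-assoc l 1ℤ 1ℤ)) (mem-mid 𝓙 l∈𝓙 l+2∈𝓙) l+2∈𝓙))
      -- rotate the block so that the known columns l + 1, l + 2 come first
      (trans (sym (minor₃-rotate M)) (tame a l a∈𝓘 a+2∈𝓘 l∈𝓙 l+2∈𝓙))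

  module _ {i j} (i∈𝓘 : mem 𝓘 i) (i+1∈𝓘 : mem 𝓘 (i + 1ℤ)) (j∈𝓙 : mem 𝓙 j) (j+1∈𝓙 : mem 𝓙 (j + 1ℤ)) where

    rank-two : ∀ {a b} → mem 𝓘 a → mem 𝓙 b → minor₃ M a i (i + 1ℤ) j (j + 1ℤ) b ≡ 0ℤ
    rank-two a∈𝓘 =
      induction₂ 𝓘 Dependent i∈𝓘 i+1∈𝓘 (λ _ → minor₃-rows₁₂ M) (λ _ → minor₃-rows₁₃ M) up down a∈𝓘
      where
      Dependent : ℤ → Set
      Dependent a = ∀ {b} → mem 𝓙 b → minor₃ M a i (i + 1ℤ) j (j + 1ℤ) b ≡ 0ℤ
      up : ∀ {x} → mem 𝓘 x → mem 𝓘 (x + + 2) → Dependent x → Dependent (x + 1ℤ) → Dependent (x + + 2)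
      up {x} x∈𝓘 x+2∈𝓘 Dx Dx+1 b∈𝓙 =
        minor₃-recurrence M (minor M x (x + + 2) j (j + 1ℤ)) N≢0
          (rec j∈𝓙) (rec j+1∈𝓙) (rec b∈𝓙) (Dx b∈𝓙) (Dx+1 b∈𝓙)
        where rec = rows-recurrence x∈𝓘 x+2∈𝓘 j∈𝓙 j+1∈𝓙
      down : ∀ {x} → mem 𝓘 x → mem 𝓘 (x + + 2) → Dependent (x + 1ℤ) → Dependent (x + + 2) → Dependent x
      down {x} x∈𝓘 x+2∈𝓘 Dx+1 Dx+2 b∈𝓙 =
        minor₃-recurrence M c N≢0 (rec j∈𝓙) (rec j+1∈𝓙) (rec b∈𝓙) (Dx+2 b∈𝓙) (Dx+1 b∈𝓙)
        where
        c = minor M x (x + + 2) j (j + 1ℤ)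
        rec : ∀ {l} → mem 𝓙 l → Recurrence M N c (x + + 2) (x + 1ℤ) x l
        rec l∈𝓙 = Recurrence-sym M N c (rows-recurrence x∈𝓘 x+2∈𝓘 j∈𝓙 j+1∈𝓙 l∈𝓙)

    N*minor≡colMinor*rowMinor : ∀ {a a′ b b′} → mem 𝓘 a → mem 𝓘 a′ → mem 𝓙 b → mem 𝓙 b′ →
      N * minor M a a′ b b′ ≡ minor M a a′ j (j + 1ℤ) * minor M i (i + 1ℤ) b b′
    N*minor≡colMinor*rowMinor {a} {a′} {b} {b′} a∈𝓘 a′∈𝓘 b∈𝓙 b′∈𝓙 =
      subst (λ n → n * minor M a a′ b b′ ≡ minor M a a′ j (j + 1ℤ) * minor M i (i + 1ℤ) b b′) pivot≡N
        (minor-factorisation M (nonsingular pivot≡N)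
          (rank-two a∈𝓘 b∈𝓙) (rank-two a∈𝓘 b′∈𝓙) (rank-two a′∈𝓘 b∈𝓙) (rank-two a′∈𝓘 b′∈𝓙))
      where pivot≡N = tiling i j i∈𝓘 i+1∈𝓘 j∈𝓙 j+1∈𝓙

    ∣colMinor∣*∣rowMinor∣≡∣N∣*∣minor∣ : ∀ {a a′ b b′} → mem 𝓘 a → mem 𝓘 a′ → mem 𝓙 b → mem 𝓙 b′ →
      ∣ minor M a a′ j (j + 1ℤ) ∣ ℕ.* ∣ minor M i (i + 1ℤ) b b′ ∣ ≡ ∣ N ∣ ℕ.* ∣ minor M a a′ b b′ ∣
    ∣colMinor∣*∣rowMinor∣≡∣N∣*∣minor∣ {a} {a′} {b} {b′} a∈𝓘 a′∈𝓘 b∈𝓙 b′∈𝓙 =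
      trans (sym (ℤ.abs-* (minor M a a′ j (j + 1ℤ)) (minor M i (i + 1ℤ) b b′)))
        (trans (cong ∣_∣ (sym (N*minor≡colMinor*rowMinor a∈𝓘 a′∈𝓘 b∈𝓙 b′∈𝓙))) (ℤ.abs-* N (minor M a a′ b b′)))

    colGCD*rowGCD≡∣N∣*minorGCD : ∀ {gr gs gt} → IsGCDOf (ColMinor 𝓘 M j) gr → IsGCDOf (RowMinor 𝓙 M i) gs →
      IsGCDOf (AnyMinor 𝓘 𝓙 M) gt → gr ℕ.* gs ≡ ∣ N ∣ ℕ.* gt
    colGCD*rowGCD≡∣N∣*minorGCD gr-gcd gs-gcd gt-gcd =
      gcd-of-products ∣ N ∣ gr-gcd gs-gcd gt-gcd col×row⇒minor minor⇒col×row
      where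
      col×row⇒minor : ∀ {x y} → ColMinor 𝓘 M j x → RowMinor 𝓙 M i y →
        ∃[ z ] (AnyMinor 𝓘 𝓙 M z × ∣ x ∣ ℕ.* ∣ y ∣ ≡ ∣ N ∣ ℕ.* ∣ z ∣)
      col×row⇒minor (a , a′ , a∈𝓘 , a′∈𝓘 , a<a′ , refl) (b , b′ , b∈𝓙 , b′∈𝓙 , b<b′ , refl) =
        minor M a a′ b b′ , (a , a′ , b , b′ , a∈𝓘 , a′∈𝓘 , b∈𝓙 , b′∈𝓙 , a<a′ , b<b′ , refl) ,
        ∣colMinor∣*∣rowMinor∣≡∣N∣*∣minor∣ a∈𝓘 a′∈𝓘 b∈𝓙 b′∈𝓙
      minor⇒col×row : ∀ {z} → AnyMinor 𝓘 𝓙 M z →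
        ∃[ x ] ∃[ y ] (ColMinor 𝓘 M j x × RowMinor 𝓙 M i y × ∣ x ∣ ℕ.* ∣ y ∣ ≡ ∣ N ∣ ℕ.* ∣ z ∣)
      minor⇒col×row (a , a′ , b , b′ , a∈𝓘 , a′∈𝓘 , b∈𝓙 , b′∈𝓙 , a<a′ , b<b′ , refl) =
        minor M a a′ j (j + 1ℤ) , minor M i (i + 1ℤ) b b′ ,
        (a , a′ , a∈𝓘 , a′∈𝓘 , a<a′ , refl) , (b , b′ , b∈𝓙 , b′∈𝓙 , b<b′ , refl) ,
        ∣colMinor∣*∣rowMinor∣≡∣N∣*∣minor∣ a∈𝓘 a′∈𝓘 b∈𝓙 b′∈𝓙

theorem3p5 : (N : ℤ) → N ≢ + 0 → (𝓘 𝓙 : IndexSet) → (M : Matrix) →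
    IsTiling N 𝓘 𝓙 M → IsTame 𝓘 𝓙 M →
    (i j : ℤ) → mem 𝓘 i → mem 𝓘 (i + 1ℤ) → mem 𝓙 j → mem 𝓙 (j + 1ℤ) →
    (gr gs gt : ℕ) →
    IsGCDOf (ColMinor 𝓘 M j) gr → IsGCDOf (RowMinor 𝓙 M i) gs →
    IsGCDOf (AnyMinor 𝓘 𝓙 M) gt →
    (R S T : ℤ) →
    N ≡ R * signedBy N gr → N ≡ S * signedBy N gs → N ≡ T * signedBy N gt →
    R * S ≡ T
theorem3p5 N N≢0 𝓘 𝓙 M tiling tame i j i∈𝓘 i+1∈𝓘 j∈𝓙 j+1∈𝓙 gr gs gt gr-gcd gs-gcd gt-gcd R S T =
  tameness-parameters-multiply R S T N≢0
    (colGCD*rowGCD≡∣N∣*minorGCD i∈𝓘 i+1∈𝓘 j∈𝓙 j+1∈𝓙 gr-gcd gs-gcd gt-gcd)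
  where open TameTiling 𝓘 𝓙 M N≢0 tiling tame
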